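{- Let $h$ and $k$ be positive integers. If $s_k\le 2^h$, then $k<M_{h-1}$, where $M_j=2^j-1$.
   Context: Sequence $s_n$: let $A_1=(5)$ and for $k\ge2$ let $A_k$ be the concatenation $A_{k-1},A_{k-1},(1)$; $A$ is the limiting infinite list; $a_0=0$, $a_n$ is the $n$th entry of $A$ for $n\ge1$, and $s_n=a_0+\cdots+a_n$. -}

module Defs where

open import Data.Nat using (ℕ; zero; suc; _+_; _∸_; _^_)
open import Data.List using (List; []; _∷_; _++_; [_])
open import Data.Maybe using (Maybe; just; nothing)

-- The finite lists A_k of the paper, indexed so that  A k  is  A_{k+1}:
--   A_1 = (5),   A_{k} = A_{k-1} ++ A_{k-1} ++ (1).
A : ℕ → List ℕ
A zero    = 5 ∷ []
A (suc k) = A k ++ A k ++ [ 1 ]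

nth : List ℕ → ℕ → ℕ
nth []       _       = 0
nth (x ∷ xs) zero    = x
nth (x ∷ xs) (suc i) = nth xs i

-- a_0 = 0, and for n ≥ 1, a_n is the n-th entry (1-based) of the limiting
-- infinite list. Each A_k is a prefix of A_{k+1} and A_{k+1} (our index k)
-- has length 2^(k+1) - 1 ≥ k + 1, so the n-th entry of the limit equals the
-- n-th entry of  A n  (paper's A_{n+1}).
a : ℕ → ℕ
a zero    = 0
a (suc n) = nth (A (suc n)) n

s : ℕ → ℕ
s zero    = a zero
s (suc n) = s n + a (suc n)

M : ℕ → ℕ
M j = 2 ^ j ∸ 1

-- Reading the nested list A_k as the postorder traversal of a complete binary
-- tree (leaves 5, internal nodes 1), every nonempty prefix of A_k has sum at
-- least 2n + 3, where n is its length: a list with this property stays so when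
-- concatenated with another one, and the trailing 1 of A_{k+1} is absorbed by
-- the surplus of the two copies of A_k in front of it. Hence s_k ≥ 2k + 3, and
-- k ≥ M_{h-1} would give s_k ≥ 2(k + 1) + 1 > 2^h.
module Submission where

open import Defs
open import Data.Nat using (ℕ; zero; suc; _+_; _*_; _∸_; _^_; _≤_; _<_; z≤n; s≤s; _≤?_)
open import Data.Nat.Properties
open import Data.Nat.ListAction using (sum)
open import Data.Nat.ListAction.Properties using (sum-++)
open import Data.Nat.Tactic.RingSolver using (solve-∀)
open import Data.List using (List; []; _∷_; _++_; [_]; _∷ʳ_; length; take)
open import Data.List.Properties using (length-++; ++-assoc; take-all)
open import Relation.Nullary using (yes; no)
open import Relation.Binary.PropositionalEquality
  using (_≡_; refl; sym; trans; cong; subst; module ≡-Reasoning)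

take-++ˡ : ∀ (xs ys : List ℕ) {n} → n ≤ length xs → take n (xs ++ ys) ≡ take n xs
take-++ˡ xs       ys {zero}  _         = refl
take-++ˡ (x ∷ xs) ys {suc n} (s≤s n≤) = cong (x ∷_) (take-++ˡ xs ys n≤)

take-length-++ : ∀ (xs ys : List ℕ) j → take (length xs + j) (xs ++ ys) ≡ xs ++ take j ys
take-length-++ []       ys j = refl
take-length-++ (x ∷ xs) ys j = cong (x ∷_) (take-length-++ xs ys j)

-- Holds for every n because nth is 0 out of range.
sum-take-suc : ∀ n (xs : List ℕ) → sum (take (suc n) xs) ≡ sum (take n xs) + nth xs n
sum-take-suc zero    []       = refl
sum-take-suc (suc n) []       = refl
sum-take-suc zero    (x ∷ xs) = +-comm x 0
sum-take-suc (suc n) (x ∷ xs) =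
  trans (cong (x +_) (sum-take-suc n xs)) (sym (+-assoc x _ (nth xs n)))

PrefixHeavy : ℕ → List ℕ → Set
PrefixHeavy c xs = ∀ n → 1 ≤ n → n ≤ length xs → 2 * n + c ≤ sum (take n xs)

prefixHeavy-sum : ∀ {c xs} → PrefixHeavy c xs → 1 ≤ length xs → 2 * length xs + c ≤ sum xs
prefixHeavy-sum {c} {xs} heavy 1≤len =
  subst (2 * length xs + c ≤_) (cong sum (take-all (length xs) xs ≤-refl))
        (heavy (length xs) 1≤len ≤-refl)

prefixHeavy-twice-length≤sum : ∀ {c xs} → PrefixHeavy c xs → 2 * length xs ≤ sum xs
prefixHeavy-twice-length≤sum {xs = []}     heavy = z≤n
prefixHeavy-twice-length≤sum {xs = x ∷ xs} heavy =
  ≤-trans (m≤m+n _ _) (prefixHeavy-sum heavy (s≤s z≤n))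

prefixHeavy-extend :
  ∀ {c} {xs ys : List ℕ} → PrefixHeavy c xs →
  (∀ j → 1 ≤ j → j ≤ length ys → 2 * (length xs + j) + c ≤ sum xs + sum (take j ys)) →
  PrefixHeavy c (xs ++ ys)
prefixHeavy-extend {c} {xs} {ys} heavy suffix n 1≤n n≤len with n ≤? length xs
... | yes n≤xs = subst (2 * n + c ≤_) (cong sum (sym (take-++ˡ xs ys n≤xs))) (heavy n 1≤n n≤xs)
... | no  n≰xs = begin
    2 * n + c                       ≡⟨ cong (λ m → 2 * m + c) (sym xs+j≡n) ⟩
    2 * (length xs + j) + c         ≤⟨ suffix j 1≤j j≤ys ⟩
    sum xs + sum (take j ys)        ≡⟨ sym (sum-++ xs (take j ys)) ⟩
    sum (xs ++ take j ys)           ≡⟨ cong sum (sym (take-length-++ xs ys j)) ⟩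
    sum (take (length xs + j) (xs ++ ys)) ≡⟨ cong (λ m → sum (take m (xs ++ ys))) xs+j≡n ⟩
    sum (take n (xs ++ ys))         ∎
  where
  open ≤-Reasoning
  j = n ∸ length xs
  xs+j≡n : length xs + j ≡ n
  xs+j≡n = m+[n∸m]≡n (<⇒≤ (≰⇒> n≰xs))
  1≤j : 1 ≤ j
  1≤j = m<n⇒0<n∸m (≰⇒> n≰xs)
  j≤ys : j ≤ length ys
  j≤ys = m≤n+o⇒m∸n≤o n (length xs) (subst (n ≤_) (length-++ xs) n≤len)

prefixHeavy-++ : ∀ {c} {xs ys : List ℕ} → PrefixHeavy c xs → PrefixHeavy c ys → PrefixHeavy c (xs ++ ys)
prefixHeavy-++ {c} {xs} {ys} heavy-xs heavy-ys = prefixHeavy-extend heavy-xs suffix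
  where
  suffix : ∀ j → 1 ≤ j → j ≤ length ys → 2 * (length xs + j) + c ≤ sum xs + sum (take j ys)
  suffix j 1≤j j≤ys =
    subst (_≤ sum xs + sum (take j ys)) (twice-+-distrib (length xs) j c)
      (+-mono-≤ (prefixHeavy-twice-length≤sum heavy-xs) (heavy-ys j 1≤j j≤ys))
    where
    twice-+-distrib : ∀ l j c → 2 * l + (2 * j + c) ≡ 2 * (l + j) + c
    twice-+-distrib = solve-∀

prefixHeavy-∷ʳ : ∀ {c} {xs : List ℕ} x → PrefixHeavy c xs →
                 2 * length xs + (2 + c) ≤ sum xs → PrefixHeavy c (xs ∷ʳ x)
prefixHeavy-∷ʳ {c} {xs} x heavy surplus = prefixHeavy-extend heavy last
  where
  last : ∀ j → 1 ≤ j → j ≤ 1 → 2 * (length xs + j) + c ≤ sum xs + sum (take j [ x ])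
  last .1 (s≤s z≤n) (s≤s z≤n) =
    subst (_≤ sum xs + (x + 0)) (twice-suc (length xs) c) (≤-trans surplus (m≤m+n _ _))
    where
    twice-suc : ∀ l c → 2 * l + (2 + c) ≡ 2 * (l + 1) + c
    twice-suc = solve-∀

length-A-suc : ∀ m → length (A (suc m)) ≡ length (A m) + suc (length (A m))
length-A-suc m =
  trans (length-++ (A m)) (cong (length (A m) +_) (trans (length-++ (A m)) (+-comm (length (A m)) 1)))

<-length-A : ∀ m → m < length (A m)
<-length-A zero    = s≤s z≤n
<-length-A (suc m) =
  subst (suc m <_) (sym (length-A-suc m)) (≤-trans (s≤s (<-length-A m)) (m≤n+m _ (length (A m))))

prefixHeavy-A : ∀ m → PrefixHeavy 3 (A m)
prefixHeavy-A zero    .1 (s≤s z≤n) (s≤s z≤n) = ≤-refl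
prefixHeavy-A (suc m) =
  subst (PrefixHeavy 3) (++-assoc (A m) (A m) [ 1 ])
    (prefixHeavy-∷ʳ 1 (prefixHeavy-++ heavy heavy) surplus)
  where
  heavy : PrefixHeavy 3 (A m)
  heavy = prefixHeavy-A m
  L : ℕ
  L = length (A m)
  total : 2 * L + 3 ≤ sum (A m)
  total = prefixHeavy-sum heavy (≤-trans (s≤s z≤n) (<-length-A m))
  regroup : ∀ l → 2 * (l + l) + 5 + 1 ≡ (2 * l + 3) + (2 * l + 3)
  regroup = solve-∀
  surplus : 2 * length (A m ++ A m) + (2 + 3) ≤ sum (A m ++ A m)
  surplus = begin
    2 * length (A m ++ A m) + 5 ≡⟨ cong (λ l → 2 * l + 5) (length-++ (A m)) ⟩
    2 * (L + L) + 5             ≤⟨ m≤m+n _ 1 ⟩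
    2 * (L + L) + 5 + 1         ≡⟨ regroup L ⟩
    (2 * L + 3) + (2 * L + 3)   ≤⟨ +-mono-≤ total total ⟩
    sum (A m) + sum (A m)       ≡⟨ sym (sum-++ (A m) (A m)) ⟩
    sum (A m ++ A m)            ∎
    where open ≤-Reasoning

s≡sum-take-A : ∀ k → s k ≡ sum (take k (A k))
s≡sum-take-A zero    = refl
s≡sum-take-A (suc k) = begin
  s k + a (suc k)                                ≡⟨ cong (_+ a (suc k)) (s≡sum-take-A k) ⟩
  sum (take k (A k)) + nth (A (suc k)) k         ≡⟨ cong (λ xs → sum xs + nth (A (suc k)) k) (sym A-prefix) ⟩
  sum (take k (A (suc k))) + nth (A (suc k)) k   ≡⟨ sym (sum-take-suc k (A (suc k))) ⟩
  sum (take (suc k) (A (suc k)))                 ∎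
  where
  open ≡-Reasoning
  A-prefix : take k (A (suc k)) ≡ take k (A k)
  A-prefix = take-++ˡ (A k) (A k ++ [ 1 ]) (<⇒≤ (<-length-A k))

s-lower-bound : ∀ k → 1 ≤ k → 2 * k + 3 ≤ s k
s-lower-bound k 1≤k =
  subst (2 * k + 3 ≤_) (sym (s≡sum-take-A k)) (prefixHeavy-A k k 1≤k (<⇒≤ (<-length-A k)))

lemma2p5 : (h k : ℕ) → 1 ≤ h → 1 ≤ k → s k ≤ 2 ^ h → k < M (h ∸ 1)
lemma2p5 (suc h) k _ 1≤k sk≤2^h = ≰⇒> λ M≤k → <⇒≱ (2^h<sk M≤k) sk≤2^h
  where
  2^h<sk : M h ≤ k → 2 ^ suc h < s k
  2^h<sk M≤k = begin-strict
    2 * 2 ^ h     ≤⟨ *-monoʳ-≤ 2 (m∸1≤o⇒m≤o+1 (2 ^ h) M≤k) ⟩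
    2 * (k + 1)   ≡⟨ *-distribˡ-+ 2 k 1 ⟩
    2 * k + 2     <⟨ +-monoʳ-< (2 * k) ≤-refl ⟩
    2 * k + 3     ≤⟨ s-lower-bound k 1≤k ⟩
    s k           ∎
    where
    open ≤-Reasoning
    m∸1≤o⇒m≤o+1 : ∀ m {o} → m ∸ 1 ≤ o → m ≤ o + 1
    m∸1≤o⇒m≤o+1 zero    _     = z≤n
    m∸1≤o⇒m≤o+1 (suc m) m≤o  = subst (suc m ≤_) (+-comm 1 _) (s≤s m≤o)
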